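{- Let $P$ be an oblivious ROABP computing $f\in\mathbb{F}[x_1,\ldots,x_N]$, where $N$ is a power of $2$, and let $\Phi$ be the multilinear formula obtained from $P$ by the conversion described in the context. If $\varphi:X\to Y\cup Z$ is a partition such that the root gate of $\Phi$ is $k$-weak with respect to $\varphi$, then $\mathrm{rank}(M_{f^\varphi})\le|\Phi|\cdot 2^{N/2-k/2}$.
   Context: $X=\{x_1,\ldots,x_N\}$. A partition is a bijection $\varphi:X\to Y\cup Z$ with $|Y|=|Z|=N/2$; $M_{f^\varphi}$ has rows indexed by monic multilinear monomials $p$ in $Y$, columns by monic multilinear monomials $q$ in $Z$, entry the coefficient of $pq$ in $f$ after substituting $\varphi(x)$ for $x$; rank over $\mathbb{F}$. $S\subseteq X$ is $k$-unbalanced if $\big||\varphi(S)\cap Y|-|\varphi(S)\cap Z|\big|>k$. An ROABP is an oblivious ABP (layered DAG, start $s$, terminal $t$, edges labelled by variables or constants, at most one variable labelling the edges leaving each layer) in which each variable labels edges of at most one layer; $[u,v]$ is the polynomial of the sub-program from $u$ to $v$; assume variables are read in order $x_1,\ldots,x_N$. Conversion: $[u,w]$, reading variables with indices in an interval $I$, is written $\sum_{v\in L}[u,v]\times[v,w]$ for a layer $L$ splitting those variables into parts of sizes $\lceil|I|/2\rceil,\lfloor|I|/2\rfloor$, recursively from $[s,t]$, giving a syntactic multilinear formula $\Phi$ (alternating $+$ and fan-in-2 $\times$ layers, $+$ root). The interval $I_v=[i_v,j_v]$ of a gate is the set of indices of variables read in its sub-program(s); $S_v=\{x_\ell: i_v\le\ell\le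 j_v\}$. A full central signature is a chain $S_{v_1}\subseteq\cdots\subseteq S_{v_\ell}$ with $|S_{v_{i+1}}|\le 2|S_{v_i}|$, where $v_1,\ldots,v_\ell$ is a leaf-to-root path of $\Phi$; it is $k$-unbalanced if some $S_{v_i}$ is $k$-unbalanced. A gate $v$ is $k$-weak w.r.t. $\varphi$ if every full central signature terminating at $v$ is $k$-unbalanced. -}

module Defs where

open import Level using (Level; _⊔_; Lift) renaming (suc to lsuc)
open import Algebra.Bundles using (CommutativeRing)
open import Data.Nat using (ℕ; zero; suc; _∸_; _^_; _≤_; _<_; ⌈_/2⌉; ∣_-_∣)
  renaming (_+_ to _+ℕ_; _*_ to _*ℕ_)
open import Data.Fin using (Fin; toℕ; _≟_)
open import Data.Fin.Subset using (Subset)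
open import Data.Bool using (Bool; true; false; if_then_else_; _∧_)
open import Data.Maybe using (Maybe; just; nothing)
open import Data.List using (List; []; _∷_; map; mapMaybe; upTo; length; foldr; filter; reverse)
open import Data.List.Relation.Binary.Subset.Propositional using (_⊆_)
open import Data.List.Relation.Unary.Any using (Any)
open import Data.Vec using (lookup; tabulate)
open import Data.Product using (Σ; ∃; _×_; _,_; proj₁; proj₂)
open import Data.Sum using (_⊎_; inj₁; inj₂; [_,_])
open import Data.Unit using (⊤; tt)
open import Relation.Nullary using (¬_)
open import Relation.Nullary.Decidable using (⌊_⌋)
open import Relation.Binary.PropositionalEquality using (_≡_)
open import Function.Bundles using (_↔_; Inverse)

record Field (c ℓ : Level) : Set (lsuc (c ⊔ ℓ)) where
  field
    commutativeRing : CommutativeRing c ℓ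
  open CommutativeRing commutativeRing public
  field
    0≉1     : ¬ (0# ≈ 1#)
    inverse : ∀ x → ¬ (x ≈ 0#) → Σ Carrier (λ y → x * y ≈ 1#)

sumℕ : (n : ℕ) → (Fin n → ℕ) → ℕ
sumℕ zero    f = 0
sumℕ (suc n) f = f Fin.zero +ℕ sumℕ n (λ i → f (Fin.suc i))
  where import Data.Fin as Fin

module _ {c ℓ : Level} (𝔽 : Field c ℓ) where
  open Field 𝔽

  ∑ : (n : ℕ) → (Fin n → Carrier) → Carrier
  ∑ zero    f = 0#
  ∑ (suc n) f = f Fin.zero + ∑ n (λ i → f (Fin.suc i))
    where import Data.Fin as Fin

  -- Rank.  rank(M) ≤ r  iff the column space of M is spanned by r vectors,
  -- i.e. M = A·B with inner dimension r.  Rows/columns indexed by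
  -- arbitrary index types R, C.

  RankAtMost : {R C : Set} → (R → C → Carrier) → ℕ → Set (c ⊔ ℓ)
  RankAtMost {R} {C} M r =
    Σ (Fin r → R → Carrier) λ v →
      (q : C) → Σ (Fin r → Carrier) λ coef →
        (p : R) → M p q ≈ ∑ r (λ k → coef k * v k p)

  -- Layers 0..len; transition j goes from layer j to layer j+1 and reads
  -- the variable  var j  (nothing = only constants on these edges).
  -- An edge label is a constant (inj₁ c) or the layer's variable (inj₂ tt).

  Label : {N : ℕ} → Maybe (Fin N) → Set c
  Label nothing  = Carrier
  Label (just _) = Carrier ⊎ Lift c ⊤

  record ROABP (N : ℕ) : Set c where
    field
      len   : ℕ
      width : ℕ → ℕ
      s     : Fin (width 0)
      t     : Fin (width len)
      var   : ℕ → Maybe (Fin N)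
      edges : (j : ℕ) → List (Fin (width j) × Fin (width (suc j)) × Label (var j))

    readsBetween : ℕ → ℕ → List (Fin N)
    readsBetween ℓ ℓ' = mapMaybe var (map (ℓ +ℕ_) (upTo (ℓ' ∸ ℓ)))

    -- the variables are read in the order x_1, …, x_N (each exactly once);
    -- in particular each variable labels edges of at most one layer
    ReadInOrder : Set
    ReadInOrder = map toℕ (readsBetween 0 len) ≡ upTo N

    -- weight of an edge label when extracting the coefficient of the
    -- multilinear monomial x_S
    weight : (S : Subset N) → (m : Maybe (Fin N)) → Label m → Carrier
    weight S nothing c = c
    weight S (just i) (inj₁ c) = if lookup S i then 0# else c
    weight S (just i) (inj₂ _) = if lookup S i then 1# else 0#

    -- coefficient of x_S in the (edge-sum) transition matrix of transition j
    transition : (S : Subset N) (j : ℕ) → Fin (width j) → Fin (width (suc j)) → Carrier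
    transition S j a b =
      foldr (λ e acc → (if ⌊ a ≟ proj₁ e ⌋ ∧ ⌊ b ≟ proj₁ (proj₂ e) ⌋
                          then weight S (var j) (proj₂ (proj₂ e)) else 0#) + acc)
            0# (edges j)

    fromStart : (S : Subset N) (ℓ : ℕ) → Fin (width ℓ) → Carrier
    fromStart S zero a = if ⌊ a ≟ s ⌋ then 1# else 0#
    fromStart S (suc ℓ) b = ∑ (width ℓ) (λ a → fromStart S ℓ a * transition S ℓ a b)

    -- coefficient of the monic multilinear monomial x_S in f = [s,t]
    -- (sum over s-t paths of the products of labels)
    coeff : Subset N → Carrier
    coeff S = fromStart S len t

    Node : Set
    Node = Σ ℕ (λ ℓ → Fin (width ℓ))

    lay : Node → ℕ
    lay = proj₁

    -- gates: leaf u w  is the leaf computing [u,w] (|I| = 1);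
    -- plus u w ℓ g  is the + gate  ∑_{v ∈ layer ℓ} g v  for [u,w];
    -- times u v w Φ₁ Φ₂ is the × gate  Φ₁ × Φ₂  for [u,v]×[v,w].
    data Formula : Set where
      leaf  : Node → Node → Formula
      plus  : Node → Node → (ℓ : ℕ) → (Fin (width ℓ) → Formula) → Formula
      times : Node → Node → Node → Formula → Formula → Formula

    size : Formula → ℕ
    size (leaf _ _) = 1
    size (plus _ _ ℓ g) = suc (sumℕ (width ℓ) (λ v → size (g v)))
    size (times _ _ _ Φ₁ Φ₂) = suc (size Φ₁ +ℕ size Φ₂)

    -- Conv u w Φ : Φ is the formula produced by the recursive conversion
    -- of [u,w] (any admissible choice of splitting layers).
    data Conv : Node → Node → Formula → Set where
      leafC : ∀ {u w} → lay u ≤ lay w →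
              length (readsBetween (lay u) (lay w)) ≡ 1 →
              Conv u w (leaf u w)
      plusC : ∀ {u w} (ℓ : ℕ) (Φ₁ Φ₂ : Fin (width ℓ) → Formula) →
              lay u ≤ ℓ → ℓ ≤ lay w →
              2 ≤ length (readsBetween (lay u) (lay w)) →
              length (readsBetween (lay u) ℓ)
                ≡ ⌈ length (readsBetween (lay u) (lay w)) /2⌉ →
              ((v : Fin (width ℓ)) → Conv u (ℓ , v) (Φ₁ v)) →
              ((v : Fin (width ℓ)) → Conv (ℓ , v) w (Φ₂ v)) →
              Conv u w (plus u w ℓ (λ v → times u (ℓ , v) w (Φ₁ v) (Φ₂ v)))

    S : Formula → List (Fin N)
    S (leaf u w) = readsBetween (lay u) (lay w)
    S (plus u w _ _) = readsBetween (lay u) (lay w)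
    S (times u _ w _ _) = readsBetween (lay u) (lay w)

    -- RootLeafPath Φ π : π = (Φ, child, grandchild, …, leaf) is a
    -- root-to-leaf path in Φ (so reverse π is a leaf-to-root path).
    data RootLeafPath : Formula → List Formula → Set where
      atLeaf : ∀ {u w} → RootLeafPath (leaf u w) (leaf u w ∷ [])
      viaPlus : ∀ {u w ℓ g} (v : Fin (width ℓ)) {π} →
                RootLeafPath (g v) π →
                RootLeafPath (plus u w ℓ g) (plus u w ℓ g ∷ π)
      viaLeft : ∀ {u v w Φ₁ Φ₂ π} → RootLeafPath Φ₁ π →
                RootLeafPath (times u v w Φ₁ Φ₂) (times u v w Φ₁ Φ₂ ∷ π)
      viaRight : ∀ {u v w Φ₁ Φ₂ π} → RootLeafPath Φ₂ π →
                 RootLeafPath (times u v w Φ₁ Φ₂) (times u v w Φ₁ Φ₂ ∷ π)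

    IsCentralChain : List (List (Fin N)) → Set
    IsCentralChain [] = ⊤
    IsCentralChain (A ∷ []) = ⊤
    IsCentralChain (A ∷ B ∷ rest) =
      (A ⊆ B) × (length B ≤ 2 *ℕ length A) × IsCentralChain (B ∷ rest)

  -- Partitions φ : X → Y ∪ Z with |Y| = |Z| = N/2, here N = 2^(n+1),
  -- X = Fin N, Y = Fin (2^n) (tagged inj₁), Z = Fin (2^n) (tagged inj₂).

  Partition : ℕ → Set
  Partition n = Fin (2 ^ suc n) ↔ (Fin (2 ^ n) ⊎ Fin (2 ^ n))

  module _ (n : ℕ) (φ : Partition n) where
    private
      N = 2 ^ suc n
      φ→ = Inverse.to φ

    inY : Fin N → Bool
    inY x = [ (λ _ → true) , (λ _ → false) ] (φ→ x)

    countY countZ : List (Fin N) → ℕ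
    countY S = length (filter (λ x → Data.Bool._≟_ (inY x) true) S)
      where import Data.Bool
    countZ S = length (filter (λ x → Data.Bool._≟_ (inY x) false) S)
      where import Data.Bool

    Unbalanced : ℕ → List (Fin N) → Set
    Unbalanced k S = k < ∣ countY S - countZ S ∣

    -- the monomial  φ⁻¹(p) φ⁻¹(q)  as a subset of X
    monomial : Subset (2 ^ n) → Subset (2 ^ n) → Subset N
    monomial p q = tabulate (λ x → [ lookup p , lookup q ] (φ→ x))

    partialDerivMatrix : ROABP N → Subset (2 ^ n) → Subset (2 ^ n) → Carrier
    partialDerivMatrix P p q = ROABP.coeff P (monomial p q)

    -- gate Φ is k-weak: every full central signature terminating at Φ
    -- (i.e. along a leaf-to-Φ path) is k-unbalanced
    Weak : (P : ROABP N) → ℕ → ROABP.Formula P → Set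
    Weak P k Φ = ∀ π → RootLeafPath Φ π →
                 IsCentralChain (reverse (map S π)) →
                 Any (λ g → Unbalanced k (S g)) π
      where open ROABP P

-- By induction along the conversion we show, for the gate Φ built
-- for a sub-program [u,w] reading the variable set V, that the matrix of
-- [u,w] has rank r with r² 2^k ≤ |Φ|² 2^|V|.  If V is k-unbalanced this
-- follows from the trivial bound r ≤ 2^min(|V∩Y|,|V∩Z|): the entries see
-- only |V∩Y| row coordinates (resp. |V∩Z| column coordinates).  Otherwise
-- Φ is a balanced + gate for [u,w] = Σ_v [u,v]·[v,w]; weakness passes to
-- the left factors [u,v] because the split is central, the right factors
-- satisfy rank² ≤ 2^|V_right|, and rank(Σ_v A_v ∘ B_v) ≤ Σ_v rk A_v · rk B_v
-- combines these by a Cauchy–Schwarz-type summation of squares.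

module Submission where

open import Level using (Level)
open import Defs
open import Data.Nat using (ℕ; zero; suc; _^_) renaming (_+_ to _+ℕ_; _*_ to _*ℕ_)
open import Data.Fin using (Fin; zero; suc; _≟_; toℕ)
open import Data.Bool using (Bool; true; false; if_then_else_)
open import Data.Product using (Σ; _×_; _,_; proj₁; proj₂)
open import Data.List using (List; []; _∷_; length)
open import Data.List.Relation.Unary.All using (All; []; _∷_)
import Data.Fin.Subset
open Data.Fin.Subset using (Subset)
open import Data.Vec using (lookup; _[_]≔_)
open import Relation.Nullary using (yes; no)
open import Relation.Nullary.Decidable using (⌊_⌋)
import Relation.Binary.PropositionalEquality as ≡

-- Finite sums.  The ∑ of Defs unfolds exactly like the library's 'sum'
-- over functional vectors, so the library's summation lemmas transfer to
-- it through the pointwise identity ∑≡sum.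

module Sums {c ℓ : Level} (𝔽 : Field c ℓ) where
  open Field 𝔽 hiding (zero)
  open import Algebra.Properties.Semiring.Sum semiring
    using (sum; sum-cong-≋; sum-cong-≗; sum-replicate-zero; ∑-comm; *-distribˡ-sum; *-distribʳ-sum)
  open import Relation.Binary.Reasoning.Setoid setoid

  ∑≡sum : ∀ n (f : Fin n → Carrier) → ∑ 𝔽 n f ≡.≡ sum f
  ∑≡sum zero    f = ≡.refl
  ∑≡sum (suc n) f = ≡.cong (f zero +_) (∑≡sum n (λ i → f (suc i)))

  ∑-cong : ∀ n {f g : Fin n → Carrier} → (∀ i → f i ≈ g i) → ∑ 𝔽 n f ≈ ∑ 𝔽 n g
  ∑-cong n {f} {g} f≈g = begin
    ∑ 𝔽 n f ≡⟨ ∑≡sum n f ⟩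
    sum f   ≈⟨ sum-cong-≋ f≈g ⟩
    sum g   ≡⟨ ∑≡sum n g ⟨
    ∑ 𝔽 n g ∎

  ∑-distribˡ : ∀ n x (f : Fin n → Carrier) → x * ∑ 𝔽 n f ≈ ∑ 𝔽 n (λ i → x * f i)
  ∑-distribˡ n x f = begin
    x * ∑ 𝔽 n f                ≡⟨ ≡.cong (x *_) (∑≡sum n f) ⟩
    x * sum f                  ≈⟨ *-distribˡ-sum x f ⟩
    sum (λ i → x * f i)        ≡⟨ ∑≡sum n _ ⟨
    ∑ 𝔽 n (λ i → x * f i)      ∎

  ∑-distribʳ : ∀ n x (f : Fin n → Carrier) → ∑ 𝔽 n f * x ≈ ∑ 𝔽 n (λ i → f i * x)
  ∑-distribʳ n x f = begin
    ∑ 𝔽 n f * x                ≡⟨ ≡.cong (_* x) (∑≡sum n f) ⟩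
    sum f * x                  ≈⟨ *-distribʳ-sum x f ⟩
    sum (λ i → f i * x)        ≡⟨ ∑≡sum n _ ⟨
    ∑ 𝔽 n (λ i → f i * x)      ∎

  ∑-swap : ∀ m n (f : Fin m → Fin n → Carrier) →
           ∑ 𝔽 m (λ i → ∑ 𝔽 n (f i)) ≈ ∑ 𝔽 n (λ j → ∑ 𝔽 m (λ i → f i j))
  ∑-swap m n f = begin
    ∑ 𝔽 m (λ i → ∑ 𝔽 n (f i))          ≡⟨ double m n f ⟩
    sum (λ i → sum (f i))              ≈⟨ ∑-comm f ⟩
    sum (λ j → sum (λ i → f i j))      ≡⟨ double n m (λ j i → f i j) ⟨
    ∑ 𝔽 n (λ j → ∑ 𝔽 m (λ i → f i j)) ∎
    where
    double : ∀ m n (g : Fin m → Fin n → Carrier) →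
             ∑ 𝔽 m (λ i → ∑ 𝔽 n (g i)) ≡.≡ sum (λ i → sum (g i))
    double m n g = ≡.trans (∑≡sum m _) (sum-cong-≗ (λ i → ∑≡sum n (g i)))

  δ : ∀ {n} → Fin n → Fin n → Carrier
  δ b v = if ⌊ b ≟ v ⌋ then 1# else 0#

  ∑-δ : ∀ n (f : Fin n → Carrier) (b : Fin n) → ∑ 𝔽 n (λ v → f v * δ b v) ≈ f b
  ∑-δ (suc n) f zero = begin
    f zero * 1# + ∑ 𝔽 n (λ v → f (suc v) * 0#)
      ≈⟨ +-cong (*-identityʳ _) (∑-cong n (λ v → zeroʳ _)) ⟩
    f zero + ∑ 𝔽 n (λ _ → 0#)
      ≡⟨ ≡.cong (f zero +_) (∑≡sum n _) ⟩
    f zero + sum {n} (λ _ → 0#)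
      ≈⟨ +-congˡ (sum-replicate-zero n) ⟩
    f zero + 0# ≈⟨ +-identityʳ _ ⟩
    f zero ∎
  ∑-δ (suc n) f (suc b) = begin
    f zero * 0# + ∑ 𝔽 n (λ v → f (suc v) * δ (suc b) (suc v))
      ≈⟨ +-cong (zeroʳ _) (∑-cong n (λ v → *-congˡ (δ-suc v))) ⟩
    0# + ∑ 𝔽 n (λ v → f (suc v) * δ b v)
      ≈⟨ +-identityˡ _ ⟩
    ∑ 𝔽 n (λ v → f (suc v) * δ b v)
      ≈⟨ ∑-δ n (λ v → f (suc v)) b ⟩
    f (suc b) ∎
    where
    δ-suc : ∀ v → δ (suc b) (suc v) ≈ δ b v
    δ-suc v with b ≟ v
    ... | yes _ = refl
    ... | no  _ = refl

module Arith where
  open import Data.Nat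
  open import Data.Nat.Properties
  open import Relation.Binary.PropositionalEquality
  open import Data.Nat.Tactic.RingSolver using (solve-∀)

  sumℕ-const : ∀ a b → sumℕ a (λ _ → b) ≡ a * b
  sumℕ-const zero    b = refl
  sumℕ-const (suc a) b = cong (b +_) (sumℕ-const a b)

  sumℕ-mono : ∀ w {f g : Fin w → ℕ} → (∀ i → f i ≤ g i) → sumℕ w f ≤ sumℕ w g
  sumℕ-mono zero    f≤g = z≤n
  sumℕ-mono (suc w) f≤g = +-mono-≤ (f≤g zero) (sumℕ-mono w (λ i → f≤g (suc i)))

  square-cancel : ∀ u v → u * u ≤ v * v → u ≤ v
  square-cancel u v h = ≮⇒≥ (λ v<u → <⇒≱ (*-mono-< v<u v<u) h)

  cross-bound : ∀ x X y Y c d → x * x * c ≤ y * y * d → X * X * c ≤ Y * Y * d →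
                x * X * c ≤ y * Y * d
  cross-bound x X y Y c d h₁ h₂ = square-cancel _ _ (begin
    (x * X * c) * (x * X * c) ≡⟨ regroup x X c ⟩
    (x * x * c) * (X * X * c) ≤⟨ *-mono-≤ h₁ h₂ ⟩
    (y * y * d) * (Y * Y * d) ≡⟨ regroup y Y d ⟨
    (y * Y * d) * (y * Y * d) ∎)
    where
    open ≤-Reasoning
    regroup : ∀ x X c → (x * X * c) * (x * X * c) ≡ (x * x * c) * (X * X * c)
    regroup = solve-∀

  sum-square-bound : ∀ w (a b : Fin w → ℕ) c d → (∀ i → a i * a i * c ≤ b i * b i * d) →
                     sumℕ w a * sumℕ w a * c ≤ sumℕ w b * sumℕ w b * d
  sum-square-bound zero    a b c d h = z≤n
  sum-square-bound (suc w) a b c d h = begin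
    (x + X) * (x + X) * c                           ≡⟨ expand x X c ⟩
    x * x * c + (x * X * c + x * X * c) + X * X * c
      ≤⟨ +-mono-≤ (+-mono-≤ (h zero) (+-mono-≤ cross cross)) rest ⟩
    y * y * d + (y * Y * d + y * Y * d) + Y * Y * d ≡⟨ expand y Y d ⟨
    (y + Y) * (y + Y) * d                           ∎
    where
    open ≤-Reasoning
    x = a zero
    X = sumℕ w (λ i → a (suc i))
    y = b zero
    Y = sumℕ w (λ i → b (suc i))
    rest = sum-square-bound w (λ i → a (suc i)) (λ i → b (suc i)) c d (λ i → h (suc i))
    cross = cross-bound x X y Y c d (h zero) rest
    expand : ∀ x X c → (x + X) * (x + X) * c ≡ x * x * c + (x * X * c + x * X * c) + X * X * c
    expand = solve-∀

  min+min+dist : ∀ y z → y ⊓ z + y ⊓ z + ∣ y - z ∣ ≡ y + z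
  min+min+dist zero    z       = refl
  min+min+dist (suc y) zero    = sym (+-identityʳ (suc y))
  min+min+dist (suc y) (suc z) = cong suc (begin
    y ⊓ z + suc (y ⊓ z) + ∣ y - z ∣ ≡⟨ cong (_+ ∣ y - z ∣) (+-suc (y ⊓ z) (y ⊓ z)) ⟩
    suc (y ⊓ z + y ⊓ z + ∣ y - z ∣) ≡⟨ cong suc (min+min+dist y z) ⟩
    suc (y + z)                     ≡⟨ +-suc y z ⟨
    y + suc z                       ∎)
    where open ≡-Reasoning

  -- the trivial bound 2^min(y,z) beats 2^((y+z)/2) by the imbalance |y-z|
  imbalance-bound : ∀ y z j → j ≤ ∣ y - z ∣ →
                    2 ^ (y ⊓ z) * 2 ^ (y ⊓ z) * 2 ^ j ≤ 2 ^ (y + z)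
  imbalance-bound y z j j≤ = begin
    2 ^ (y ⊓ z) * 2 ^ (y ⊓ z) * 2 ^ j ≡⟨ cong (_* 2 ^ j) (^-distribˡ-+-* 2 (y ⊓ z) (y ⊓ z)) ⟨
    2 ^ (y ⊓ z + y ⊓ z) * 2 ^ j       ≡⟨ ^-distribˡ-+-* 2 (y ⊓ z + y ⊓ z) j ⟨
    2 ^ (y ⊓ z + y ⊓ z + j)           ≤⟨ ^-monoʳ-≤ 2 (+-monoʳ-≤ (y ⊓ z + y ⊓ z) j≤) ⟩
    2 ^ (y ⊓ z + y ⊓ z + ∣ y - z ∣)   ≡⟨ cong (2 ^_) (min+min+dist y z) ⟩
    2 ^ (y + z)                       ∎
    where open ≤-Reasoning

  product-bound : ∀ r₁ r₂ s k L₁ L₂ → r₁ * r₁ * 2 ^ k ≤ s * s * 2 ^ L₁ → r₂ * r₂ ≤ 2 ^ L₂ →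
                  (r₁ * r₂) * (r₁ * r₂) * 2 ^ k ≤ s * s * 2 ^ (L₁ + L₂)
  product-bound r₁ r₂ s k L₁ L₂ h₁ h₂ = begin
    (r₁ * r₂) * (r₁ * r₂) * 2 ^ k ≡⟨ regroup r₁ r₂ (2 ^ k) ⟩
    (r₁ * r₁ * 2 ^ k) * (r₂ * r₂) ≤⟨ *-mono-≤ h₁ h₂ ⟩
    (s * s * 2 ^ L₁) * 2 ^ L₂     ≡⟨ *-assoc (s * s) _ _ ⟩
    s * s * (2 ^ L₁ * 2 ^ L₂)     ≡⟨ cong (s * s *_) (^-distribˡ-+-* 2 L₁ L₂) ⟨
    s * s * 2 ^ (L₁ + L₂)         ∎
    where
    open ≤-Reasoning
    regroup : ∀ a b c → (a * b) * (a * b) * c ≡ (a * a * c) * (b * b)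
    regroup = solve-∀

  ≤-square-multiple : ∀ s x → 1 ≤ s → x ≤ s * s * x
  ≤-square-multiple s x 1≤s = begin
    x         ≡⟨ *-identityˡ x ⟨
    1 * x     ≤⟨ *-monoˡ-≤ x (*-mono-≤ 1≤s 1≤s) ⟩
    s * s * x ∎
    where open ≤-Reasoning

  -- a central split keeps at least half of the variables on the left
  ≤-twice-⌈/2⌉ : ∀ m → m ≤ 2 * ⌈ m /2⌉
  ≤-twice-⌈/2⌉ m = begin
    m                 ≡⟨ ⌊n/2⌋+⌈n/2⌉≡n m ⟨
    ⌊ m /2⌋ + ⌈ m /2⌉ ≤⟨ +-monoˡ-≤ ⌈ m /2⌉ (⌊n/2⌋≤⌈n/2⌉ m) ⟩
    ⌈ m /2⌉ + ⌈ m /2⌉ ≡⟨ cong (⌈ m /2⌉ +_) (+-identityʳ _) ⟨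
    2 * ⌈ m /2⌉       ∎
    where open ≤-Reasoning

module Agreement where
  open import Data.Vec.Properties using (lookup∘update; lookup∘update′)
  import Data.List.Relation.Unary.All as All
  open ≡ using (_≡_)

  Agree : ∀ {m} → List (Fin m) → Subset m → Subset m → Set
  Agree A p p' = All (λ y → lookup p y ≡ lookup p' y) A

  agree-everywhere : ∀ {m} (A : List (Fin m)) {p p' : Subset m} →
                     (∀ y → lookup p y ≡ lookup p' y) → Agree A p p'
  agree-everywhere A p≗p' = All.tabulate (λ {y} _ → p≗p' y)

  update-same : ∀ {m} (p : Subset m) y {b} → lookup p y ≡ b →
                ∀ z → lookup p z ≡ lookup (p [ y ]≔ b) z
  update-same p y {b} eq z with z ≟ y
  ... | yes ≡.refl = ≡.trans eq (≡.sym (lookup∘update y p b))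
  ... | no  z≢y    = ≡.sym (lookup∘update′ z≢y p b)

  agree-update : ∀ {m} (A : List (Fin m)) {p p' : Subset m} y b → Agree A p p' →
                 Agree (y ∷ A) (p [ y ]≔ b) (p' [ y ]≔ b)
  agree-update A {p} {p'} y b agree =
    ≡.trans (lookup∘update y p b) (≡.sym (lookup∘update y p' b)) ∷ All.map kept agree
    where
    kept : ∀ {z} → lookup p z ≡ lookup p' z → lookup (p [ y ]≔ b) z ≡ lookup (p' [ y ]≔ b) z
    kept {z} eq with z ≟ y
    ... | yes ≡.refl = ≡.trans (lookup∘update y p b) (≡.sym (lookup∘update y p' b))
    ... | no  z≢y    = ≡.trans (lookup∘update′ z≢y p b) (≡.trans eq (≡.sym (lookup∘update′ z≢y p' b)))

module Rank {c ℓ : Level} (𝔽 : Field c ℓ) where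
  open Field 𝔽 hiding (zero)
  open Sums 𝔽
  open Agreement
  open import Data.Bool using (not)
  open import Algebra.Properties.CommutativeSemigroup *-commutativeSemigroup using (x∙yz≈y∙xz)
  import Data.Nat.Properties as ℕₚ
  open import Relation.Binary.Reasoning.Setoid setoid

  Rank : {R C : Set} → (R → C → Carrier) → ℕ → Set (c Level.⊔ ℓ)
  Rank = RankAtMost 𝔽

  rank-cong : ∀ {R C} {M M' : R → C → Carrier} {r} →
              (∀ p q → M p q ≈ M' p q) → Rank M r → Rank M' r
  rank-cong M≈M' (v , span) =
    v , λ q → proj₁ (span q) , λ p → trans (sym (M≈M' p q)) (proj₂ (span q) p)

  -- M = A·B gives Mᵀ = Bᵀ·Aᵀ: the spanning vectors and coefficients swap roles
  rank-transpose : ∀ {R C} {M : R → C → Carrier} {r} → Rank M r → Rank (λ q p → M p q) r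
  rank-transpose {r = r} (v , span) =
    (λ k q → proj₁ (span q) k) , λ p → (λ k → v k p) , λ q →
      trans (proj₂ (span q) p) (∑-cong r (λ k → *-comm _ _))

  rank-zero : ∀ {R C} → Rank {R} {C} (λ _ _ → 0#) 0
  rank-zero = (λ ()) , λ q → (λ ()) , λ p → refl

  rank-constant-rows : ∀ {R C} (g : C → Carrier) → Rank {R} {C} (λ p q → g q) 1
  rank-constant-rows g = (λ _ _ → 1#) , λ q → (λ _ → g q) , λ p →
    sym (trans (+-identityʳ _) (*-identityʳ _))

  -- subadditivity: concatenate the two spanning families
  rank-+ : ∀ {R C} {M M' : R → C → Carrier} {a b} → Rank M a → Rank M' b →
           Rank (λ p q → M p q + M' p q) (a +ℕ b)
  rank-+ {R} {C} {M} {M'} {a} {b} (v , span) (v' , span') =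
    append a v v' , λ q → append a (proj₁ (span q)) (proj₁ (span' q)) , λ p →
      trans (+-cong (proj₂ (span q) p) (proj₂ (span' q) p))
            (sym (∑-append a (proj₁ (span q)) (proj₁ (span' q)) v v' p))
    where
    append : ∀ {X : Set c} a → (Fin a → X) → (Fin b → X) → Fin (a +ℕ b) → X
    append zero    f g k       = g k
    append (suc a) f g zero    = f zero
    append (suc a) f g (suc k) = append a (λ i → f (suc i)) g k
    ∑-append : ∀ a (f : Fin a → Carrier) (g : Fin b → Carrier)
               (F : Fin a → R → Carrier) (G : Fin b → R → Carrier) p →
               ∑ 𝔽 (a +ℕ b) (λ k → append a f g k * append a F G k p)
               ≈ ∑ 𝔽 a (λ k → f k * F k p) + ∑ 𝔽 b (λ k → g k * G k p)
    ∑-append zero    f g F G p = sym (+-identityˡ _)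
    ∑-append (suc a) f g F G p =
      trans (+-congˡ (∑-append a _ _ _ _ p)) (sym (+-assoc _ _ _))

  rank-∑ : ∀ {R C} w {M : Fin w → R → C → Carrier} {r : Fin w → ℕ} →
           (∀ i → Rank (M i) (r i)) → Rank (λ p q → ∑ 𝔽 w (λ i → M i p q)) (sumℕ w r)
  rank-∑ zero    ranks = rank-zero
  rank-∑ (suc w) ranks = rank-+ (ranks zero) (rank-∑ w (λ i → ranks (suc i)))

  rank-scale-rows : ∀ {R C} {M : R → C → Carrier} {r} (g : R → Carrier) →
                    Rank M r → Rank (λ p q → g p * M p q) r
  rank-scale-rows {M = M} {r} g (v , span) =
    (λ k p → g p * v k p) , λ q → proj₁ (span q) , λ p → begin
      g p * M p q                                    ≈⟨ *-congˡ (proj₂ (span q) p) ⟩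
      g p * ∑ 𝔽 r (λ k → proj₁ (span q) k * v k p)  ≈⟨ ∑-distribˡ r (g p) _ ⟩
      ∑ 𝔽 r (λ k → g p * (proj₁ (span q) k * v k p)) ≈⟨ ∑-cong r (λ k → x∙yz≈y∙xz _ _ _) ⟩
      ∑ 𝔽 r (λ k → proj₁ (span q) k * (g p * v k p)) ∎

  rank-scale-columns : ∀ {R C} {M : R → C → Carrier} {r} (g : C → Carrier) →
                       Rank M r → Rank (λ p q → g q * M p q) r
  rank-scale-columns g = rank-transpose ∘′ rank-scale-rows g ∘′ rank-transpose
    where open import Function using (_∘′_)

  rank-hadamard : ∀ {R C} {A B : R → C → Carrier} {a b} → Rank A a → Rank B b →
                  Rank (λ p q → A p q * B p q) (a *ℕ b)
  rank-hadamard {A = A} {B} {a} {b} (v , span) rankB =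
    ≡.subst (Rank _) (Arith.sumℕ-const a b)
      (rank-cong (λ p q → sym (expand p q))
        (rank-∑ a (λ k → rank-scale-columns (λ q → proj₁ (span q) k)
                           (rank-scale-rows (v k) rankB))))
    where
    expand : ∀ p q → A p q * B p q ≈ ∑ 𝔽 a (λ k → proj₁ (span q) k * (v k p * B p q))
    expand p q = begin
      A p q * B p q                                        ≈⟨ *-congʳ (proj₂ (span q) p) ⟩
      ∑ 𝔽 a (λ k → proj₁ (span q) k * v k p) * B p q       ≈⟨ ∑-distribʳ a _ _ ⟩
      ∑ 𝔽 a (λ k → (proj₁ (span q) k * v k p) * B p q)     ≈⟨ ∑-cong a (λ k → *-assoc _ _ _) ⟩
      ∑ 𝔽 a (λ k → proj₁ (span q) k * (v k p * B p q))     ∎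

  -- rows indexed by subsets of Fin m, entries depending only on the
  -- coordinates listed in A: split on the first coordinate and recurse
  rank-few-row-coordinates :
    ∀ {m} {C : Set} (A : List (Fin m)) (M : Subset m → C → Carrier) →
    (∀ p p' q → Agree A p p' → M p q ≈ M p' q) → Rank M (2 ^ length A)
  rank-few-row-coordinates [] M local =
    rank-cong (λ p q → local Data.Fin.Subset.⊥ p q []) (rank-constant-rows (M Data.Fin.Subset.⊥))
  rank-few-row-coordinates (y ∷ A) M local =
    rank-cong (λ p q → sym (split p q))
      (≡.subst (Rank _) (≡.cong (2 ^ length A +ℕ_) (≡.sym (ℕₚ.+-identityʳ _)))
        (rank-+ (rank-scale-rows (λ p → χ (lookup p y)) (half true))
                (rank-scale-rows (λ p → χ (not (lookup p y))) (half false))))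
    where
    χ : Bool → Carrier
    χ true  = 1#
    χ false = 0#
    -- with coordinate y fixed to b, the entries see only A
    half : ∀ b → Rank (λ p q → M (p [ y ]≔ b) q) (2 ^ length A)
    half b = rank-few-row-coordinates A _ (λ p p' q agree → local _ _ q (agree-update A {p} {p'} y b agree))
    fix : ∀ p q {b} → lookup p y ≡.≡ b → M p q ≈ M (p [ y ]≔ b) q
    fix p q {b} eq = local _ _ q (agree-everywhere (y ∷ A) {p} {p [ y ]≔ b} (update-same p y eq))
    split : ∀ p q → M p q ≈ χ (lookup p y) * M (p [ y ]≔ true) q
                           + χ (not (lookup p y)) * M (p [ y ]≔ false) q
    split p q with lookup p y in eq
    ... | true  = trans (fix p q eq) (sym (trans (+-cong (*-identityˡ _) (zeroˡ _)) (+-identityʳ _)))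
    ... | false = trans (fix p q eq) (sym (trans (+-cong (zeroˡ _) (*-identityˡ _)) (+-identityˡ _)))

  rank-few-column-coordinates :
    ∀ {m} {R : Set} (B : List (Fin m)) (M : R → Subset m → Carrier) →
    (∀ p q q' → Agree B q q' → M p q ≈ M p q') → Rank M (2 ^ length B)
  rank-few-column-coordinates B M local =
    rank-transpose (rank-few-row-coordinates B (λ q p → M p q) (λ q q' p → local p q q'))

-- The monomial x_{p,q} = φ⁻¹(p)φ⁻¹(q) restricted to a
-- set L of variables is determined by p on the Y-images of L and by q on
-- the Z-images of L.  Hence a matrix F(x_{p,q}) whose entries only see
-- the variables in L has rank at most 2^min(|Y∩L|,|Z∩L|), which is small
-- when L is unbalanced.

module Monomials {c ℓ : Level} (𝔽 : Field c ℓ) (n : ℕ) (φ : Partition 𝔽 n) where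
  open Field 𝔽 hiding (zero)
  open Rank 𝔽
  open Agreement
  open import Data.Nat using (_≤_; _⊓_; ∣_-_∣)
  import Data.Nat.Properties as ℕₚ
  open import Data.Sum using (inj₁; inj₂; [_,_])
  open import Data.Vec.Properties using (lookup∘tabulate)
  open import Function.Bundles using (Inverse)

  private
    φ→ = Inverse.to φ

  ys zs : List (Fin (2 ^ suc n)) → List (Fin (2 ^ n))
  ys []       = []
  ys (x ∷ xs) = [ (λ y → y ∷ ys xs) , (λ _ → ys xs) ] (φ→ x)
  zs []       = []
  zs (x ∷ xs) = [ (λ _ → zs xs) , (λ z → z ∷ zs xs) ] (φ→ x)

  length-ys : ∀ L → length (ys L) ≡.≡ countY 𝔽 n φ L
  length-ys []       = ≡.refl
  length-ys (x ∷ xs) with φ→ x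
  ... | inj₁ _ = ≡.cong suc (length-ys xs)
  ... | inj₂ _ = length-ys xs

  length-zs : ∀ L → length (zs L) ≡.≡ countZ 𝔽 n φ L
  length-zs []       = ≡.refl
  length-zs (x ∷ xs) with φ→ x
  ... | inj₁ _ = length-zs xs
  ... | inj₂ _ = ≡.cong suc (length-zs xs)

  countY+countZ : ∀ L → countY 𝔽 n φ L +ℕ countZ 𝔽 n φ L ≡.≡ length L
  countY+countZ []       = ≡.refl
  countY+countZ (x ∷ xs) with φ→ x
  ... | inj₁ _ = ≡.cong suc (countY+countZ xs)
  ... | inj₂ _ = ≡.trans (ℕₚ.+-suc _ _) (≡.cong suc (countY+countZ xs))

  lookup-monomial : ∀ p q x {v} → φ→ x ≡.≡ v →
                    lookup (monomial 𝔽 n φ p q) x ≡.≡ [ lookup p , lookup q ] v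
  lookup-monomial p q x eq = ≡.trans (lookup∘tabulate _ x) (≡.cong [ lookup p , lookup q ] eq)

  monomial-agree : ∀ L p p' q q' → Agree (ys L) p p' → Agree (zs L) q q' →
                   Agree L (monomial 𝔽 n φ p q) (monomial 𝔽 n φ p' q')
  monomial-agree []       _ _  _ _  _      _      = []
  monomial-agree (x ∷ xs) p p' q q' agreeY agreeZ with φ→ x in eq
  monomial-agree (x ∷ xs) p p' q q' (e ∷ agreeY) agreeZ | inj₁ y =
    ≡.trans (lookup-monomial p q x eq) (≡.trans e (≡.sym (lookup-monomial p' q' x eq)))
    ∷ monomial-agree xs p p' q q' agreeY agreeZ
  monomial-agree (x ∷ xs) p p' q q' agreeY (e ∷ agreeZ) | inj₂ z =
    ≡.trans (lookup-monomial p q x eq) (≡.trans e (≡.sym (lookup-monomial p' q' x eq)))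
    ∷ monomial-agree xs p p' q q' agreeY agreeZ

  local-rank-bound :
    ∀ L (F : Subset (2 ^ suc n) → Carrier) → (∀ S S' → Agree L S S' → F S ≈ F S') →
    Σ ℕ λ r → Rank (λ p q → F (monomial 𝔽 n φ p q)) r
            × (∀ j → j ≤ ∣ countY 𝔽 n φ L - countZ 𝔽 n φ L ∣ → r *ℕ r *ℕ 2 ^ j ≤ 2 ^ length L)
  local-rank-bound L F local = 2 ^ (y ⊓ z) , rank , bound
    where
    y = countY 𝔽 n φ L
    z = countZ 𝔽 n φ L
    same : ∀ {m} (A : List (Fin m)) p → Agree A p p
    same A p = agree-everywhere A {p} {p} (λ _ → ≡.refl)
    byRows : Rank (λ p q → F (monomial 𝔽 n φ p q)) (2 ^ y)
    byRows = ≡.subst (Rank _) (≡.cong (2 ^_) (length-ys L))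
      (rank-few-row-coordinates (ys L) _ (λ p p' q agree → local _ _ (monomial-agree L p p' q q agree (same (zs L) q))))
    byColumns : Rank (λ p q → F (monomial 𝔽 n φ p q)) (2 ^ z)
    byColumns = ≡.subst (Rank _) (≡.cong (2 ^_) (length-zs L))
      (rank-few-column-coordinates (zs L) _ (λ p q q' agree → local _ _ (monomial-agree L p p q q' (same (ys L) p) agree)))
    rank : Rank (λ p q → F (monomial 𝔽 n φ p q)) (2 ^ (y ⊓ z))
    rank with ℕₚ.≤-total y z
    ... | inj₁ y≤z = ≡.subst (Rank _) (≡.cong (2 ^_) (≡.sym (ℕₚ.m≤n⇒m⊓n≡m y≤z))) byRows
    ... | inj₂ z≤y = ≡.subst (Rank _) (≡.cong (2 ^_) (≡.sym (ℕₚ.m≥n⇒m⊓n≡n z≤y))) byColumns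
    bound : ∀ j → j ≤ ∣ y - z ∣ → 2 ^ (y ⊓ z) *ℕ 2 ^ (y ⊓ z) *ℕ 2 ^ j ≤ 2 ^ length L
    bound j j≤ = ≡.subst (λ e → 2 ^ (y ⊓ z) *ℕ 2 ^ (y ⊓ z) *ℕ 2 ^ j ≤ 2 ^ e) (countY+countZ L)
                   (Arith.imbalance-bound y z j j≤)

module Reads {c ℓ : Level} (𝔽 : Field c ℓ) {N : ℕ} (P : ROABP 𝔽 N) where
  open ROABP P using (var; readsBetween)
  open import Data.Nat using (_≤_; _≤′_; ≤′-refl; ≤′-step; _∸_)
  import Data.Nat.Properties as ℕₚ
  open import Data.List using (map; mapMaybe; upTo; _++_)
  import Data.List.Properties as Listₚ
  open ≡.≡-Reasoning

  readsBetween-self : ∀ a → readsBetween a a ≡.≡ []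
  readsBetween-self a rewrite ℕₚ.n∸n≡0 a = ≡.refl

  readsBetween-step : ∀ a m → a ≤ m → readsBetween a (suc m) ≡.≡ readsBetween a m ++ mapMaybe var (m ∷ [])
  readsBetween-step a m a≤m = begin
    mapMaybe var (map (a +ℕ_) (upTo (suc m ∸ a)))
      ≡⟨ ≡.cong (λ d → mapMaybe var (map (a +ℕ_) (upTo d))) (ℕₚ.+-∸-assoc 1 a≤m) ⟩
    mapMaybe var (map (a +ℕ_) (upTo (suc (m ∸ a))))
      ≡⟨ ≡.cong (λ l → mapMaybe var (map (a +ℕ_) l)) (Listₚ.upTo-∷ʳ (m ∸ a)) ⟨
    mapMaybe var (map (a +ℕ_) (upTo (m ∸ a) ++ (m ∸ a ∷ [])))
      ≡⟨ ≡.cong (mapMaybe var) (Listₚ.map-++ (a +ℕ_) (upTo (m ∸ a)) _) ⟩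
    mapMaybe var (map (a +ℕ_) (upTo (m ∸ a)) ++ (a +ℕ (m ∸ a) ∷ []))
      ≡⟨ Listₚ.mapMaybe-++ var (map (a +ℕ_) (upTo (m ∸ a))) _ ⟩
    readsBetween a m ++ mapMaybe var (a +ℕ (m ∸ a) ∷ [])
      ≡⟨ ≡.cong (λ k → readsBetween a m ++ mapMaybe var (k ∷ [])) (ℕₚ.m+[n∸m]≡n a≤m) ⟩
    readsBetween a m ++ mapMaybe var (m ∷ []) ∎

  readsBetween-split : ∀ a b c → a ≤ b → b ≤ c → readsBetween a c ≡.≡ readsBetween a b ++ readsBetween b c
  readsBetween-split a b c a≤b b≤c = go c (ℕₚ.≤⇒≤′ b≤c)
    where
    go : ∀ c → b ≤′ c → readsBetween a c ≡.≡ readsBetween a b ++ readsBetween b c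
    go .b ≤′-refl = ≡.sym (≡.trans (≡.cong (readsBetween a b ++_) (readsBetween-self b))
                                   (Listₚ.++-identityʳ _))
    go (suc c) (≤′-step b≤c) = begin
      readsBetween a (suc c)
        ≡⟨ readsBetween-step a c (ℕₚ.≤-trans a≤b (ℕₚ.≤′⇒≤ b≤c)) ⟩
      readsBetween a c ++ mapMaybe var (c ∷ [])
        ≡⟨ ≡.cong (_++ mapMaybe var (c ∷ [])) (go c b≤c) ⟩
      (readsBetween a b ++ readsBetween b c) ++ mapMaybe var (c ∷ [])
        ≡⟨ Listₚ.++-assoc (readsBetween a b) _ _ ⟩
      readsBetween a b ++ (readsBetween b c ++ mapMaybe var (c ∷ []))
        ≡⟨ ≡.cong (readsBetween a b ++_) (readsBetween-step b c (ℕₚ.≤′⇒≤ b≤c)) ⟨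
      readsBetween a b ++ readsBetween b (suc c) ∎

  length-all-reads : ROABP.ReadInOrder P → length (readsBetween 0 (ROABP.len P)) ≡.≡ N
  length-all-reads inOrder = begin
    length (readsBetween 0 (ROABP.len P))               ≡⟨ Listₚ.length-map toℕ (readsBetween 0 (ROABP.len P)) ⟨
    length (map toℕ (readsBetween 0 (ROABP.len P)))     ≡⟨ ≡.cong length inOrder ⟩
    length (upTo N)                                     ≡⟨ Listₚ.length-upTo N ⟩
    N                                                   ∎

-- Path sums in the ROABP.  pathSum u S m b is the coefficient of x_S in
-- the sub-program [u,(m,b)].

module Paths {c ℓ : Level} (𝔽 : Field c ℓ) {N : ℕ} (P : ROABP 𝔽 N) where
  open Field 𝔽 hiding (zero)
  open Sums 𝔽
  open Agreement
  open ROABP P using (width; var; edges; weight; transition; fromStart; readsBetween; Node; lay)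
  open Reads 𝔽 P using (readsBetween-step)
  open import Data.Nat using (_≤_; _≤′_; ≤′-refl; ≤′-step; _≤?_; z≤n) renaming (_≟_ to _≟ℕ_)
  import Data.Nat.Properties as ℕₚ
  open import Data.Bool using (_∧_)
  open import Data.Maybe using (Maybe; just; nothing)
  open import Data.Sum using (inj₁; inj₂)
  open import Data.List using (foldr; catMaybes)
  import Data.List.Relation.Unary.All.Properties as Allₚ
  open import Data.Empty using (⊥-elim)
  open import Relation.Binary.Reasoning.Setoid setoid

  startAt : Node → (m : ℕ) → Fin (width m) → Carrier
  startAt u m b with m ≟ℕ lay u
  ... | yes eq = δ b (≡.subst (λ i → Fin (width i)) (≡.sym eq) (proj₂ u))
  ... | no  _  = 0#

  pathSum : Node → Subset N → (m : ℕ) → Fin (width m) → Carrier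
  pathSum u S zero    b = startAt u zero b
  pathSum u S (suc m) b with lay u ≤? m
  ... | yes _ = ∑ 𝔽 (width m) (λ a → pathSum u S m a * transition S m a b)
  ... | no  _ = startAt u (suc m) b

  startAt-self : ∀ m v b → startAt (m , v) m b ≡.≡ δ b v
  startAt-self m v b with m ≟ℕ m
  ... | yes eq rewrite ℕₚ.≡-irrelevant eq ≡.refl = ≡.refl
  ... | no  m≢m = ⊥-elim (m≢m ≡.refl)

  pathSum-self : ∀ S m v b → pathSum (m , v) S m b ≈ δ b v
  pathSum-self S zero    v b = reflexive (startAt-self zero v b)
  pathSum-self S (suc m) v b with suc m ≤? m
  ... | yes m<m = ⊥-elim (ℕₚ.n≮n m m<m)
  ... | no  _   = reflexive (startAt-self (suc m) v b)

  pathSum-step : ∀ u S m b → lay u ≤ m →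
    pathSum u S (suc m) b ≡.≡ ∑ 𝔽 (width m) (λ a → pathSum u S m a * transition S m a b)
  pathSum-step u S m b u≤m with lay u ≤? m
  ... | yes _   = ≡.refl
  ... | no  u≰m = ⊥-elim (u≰m u≤m)

  -- Chapman–Kolmogorov: split every path at its node on layer ℓ
  pathSum-split : ∀ u S ℓ → lay u ≤ ℓ → ∀ m → ℓ ≤′ m → ∀ b →
    pathSum u S m b ≈ ∑ 𝔽 (width ℓ) (λ v → pathSum u S ℓ v * pathSum (ℓ , v) S m b)
  pathSum-split u S ℓ u≤ℓ .ℓ ≤′-refl b = sym (begin
    ∑ 𝔽 (width ℓ) (λ v → pathSum u S ℓ v * pathSum (ℓ , v) S ℓ b)
      ≈⟨ ∑-cong (width ℓ) (λ v → *-congˡ (pathSum-self S ℓ v b)) ⟩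
    ∑ 𝔽 (width ℓ) (λ v → pathSum u S ℓ v * δ b v)
      ≈⟨ ∑-δ (width ℓ) _ b ⟩
    pathSum u S ℓ b ∎)
  pathSum-split u S ℓ u≤ℓ (suc m) (≤′-step ℓ≤m) b = begin
    pathSum u S (suc m) b
      ≡⟨ pathSum-step u S m b (ℕₚ.≤-trans u≤ℓ (ℕₚ.≤′⇒≤ ℓ≤m)) ⟩
    ∑ 𝔽 (width m) (λ a → pathSum u S m a * T a)
      ≈⟨ ∑-cong (width m) (λ a → *-congʳ (pathSum-split u S ℓ u≤ℓ m ℓ≤m a)) ⟩
    ∑ 𝔽 (width m) (λ a → ∑ 𝔽 (width ℓ) (λ v → L v * R v a) * T a)
      ≈⟨ ∑-cong (width m) (λ a → trans (∑-distribʳ (width ℓ) _ _)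
                                        (∑-cong (width ℓ) (λ v → *-assoc _ _ _))) ⟩
    ∑ 𝔽 (width m) (λ a → ∑ 𝔽 (width ℓ) (λ v → L v * (R v a * T a)))
      ≈⟨ ∑-swap (width m) (width ℓ) _ ⟩
    ∑ 𝔽 (width ℓ) (λ v → ∑ 𝔽 (width m) (λ a → L v * (R v a * T a)))
      ≈⟨ ∑-cong (width ℓ) (λ v → sym (∑-distribˡ (width m) _ _)) ⟩
    ∑ 𝔽 (width ℓ) (λ v → L v * ∑ 𝔽 (width m) (λ a → R v a * T a))
      ≈⟨ ∑-cong (width ℓ) (λ v → *-congˡ (reflexive (≡.sym (pathSum-step (ℓ , v) S m b (ℕₚ.≤′⇒≤ ℓ≤m))))) ⟩
    ∑ 𝔽 (width ℓ) (λ v → L v * pathSum (ℓ , v) S (suc m) b) ∎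
    where
    L = λ v → pathSum u S ℓ v
    R = λ v a → pathSum (ℓ , v) S m a
    T = λ a → transition S m a b

  fromStart≈pathSum : ∀ S m b → fromStart S m b ≈ pathSum (0 , ROABP.s P) S m b
  fromStart≈pathSum S zero    b = reflexive (≡.sym (startAt-self zero (ROABP.s P) b))
  fromStart≈pathSum S (suc m) b = trans
    (∑-cong (width m) (λ a → *-congʳ (fromStart≈pathSum S m a)))
    (reflexive (≡.sym (pathSum-step (0 , ROABP.s P) S m b z≤n)))

  -- Locality: the weights of transition j see only the variable var j,
  -- so the path sum up to layer m sees only the variables read before m.
  AgreeOn : Maybe (Fin N) → Subset N → Subset N → Set
  AgreeOn v S S' = ∀ i → v ≡.≡ just i → lookup S i ≡.≡ lookup S' i

  agreeOn-read : ∀ v {S S'} → Agree (catMaybes (v ∷ [])) S S' → AgreeOn v S S'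
  agreeOn-read (just i) (e ∷ []) .i ≡.refl = e
  agreeOn-read nothing  _        i ()

  weight-local : ∀ {S S'} v (lb : Label 𝔽 v) → AgreeOn v S S' → weight S v lb ≡.≡ weight S' v lb
  weight-local nothing  lb       _     = ≡.refl
  weight-local (just i) (inj₁ x) agree = ≡.cong (λ t → if t then 0# else x) (agree i ≡.refl)
  weight-local (just i) (inj₂ _) agree = ≡.cong (λ t → if t then 1# else 0#) (agree i ≡.refl)

  transition-local : ∀ {S S'} j a b → AgreeOn (var j) S S' → transition S j a b ≡.≡ transition S' j a b
  transition-local {S} {S'} j a b agree = go (edges j)
    where
    selected : Subset N → _ → Carrier
    selected T e = if ⌊ a ≟ proj₁ e ⌋ ∧ ⌊ b ≟ proj₁ (proj₂ e) ⌋ then weight T (var j) (proj₂ (proj₂ e)) else 0#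
    go : ∀ es → foldr (λ e acc → selected S e + acc) 0# es ≡.≡ foldr (λ e acc → selected S' e + acc) 0# es
    go []       = ≡.refl
    go (e ∷ es) = ≡.cong₂ (λ w r → (if ⌊ a ≟ proj₁ e ⌋ ∧ ⌊ b ≟ proj₁ (proj₂ e) ⌋ then w else 0#) + r)
                          (weight-local (var j) (proj₂ (proj₂ e)) agree) (go es)

  pathSum-local : ∀ u S S' m b → Agree (readsBetween (lay u) m) S S' → pathSum u S m b ≈ pathSum u S' m b
  pathSum-local u S S' zero    b agree = refl
  pathSum-local u S S' (suc m) b agree with lay u ≤? m
  ... | no  _   = refl
  ... | yes u≤m with Allₚ.++⁻ (readsBetween (lay u) m)
                      (≡.subst (λ L → Agree L S S') (readsBetween-step (lay u) m u≤m) agree)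
  ...   | before , last = ∑-cong (width m) (λ a →
            *-cong (pathSum-local u S S' m a before)
                   (reflexive (transition-local m a b (agreeOn-read (var m) {S} {S'} last))))

module Chains {c ℓ : Level} (𝔽 : Field c ℓ) {N : ℕ} (P : ROABP 𝔽 N) where
  open ROABP P using (IsCentralChain; Formula; RootLeafPath; atLeaf; viaPlus; viaLeft; viaRight)
  open import Data.Nat using (_≤_)
  open import Data.List using (reverse; _∷ʳ_)
  import Data.List.Properties as Listₚ
  open import Data.List.Relation.Binary.Subset.Propositional using (_⊆_)
  open import Data.Unit using (tt)

  chain-snoc : ∀ xs A B → IsCentralChain (xs ∷ʳ A) → A ⊆ B → length B ≤ 2 *ℕ length A →
               IsCentralChain (xs ∷ʳ A ∷ʳ B)
  chain-snoc []            A B _                  A⊆B small = A⊆B , small , tt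
  chain-snoc (x ∷ [])      A B (x⊆ , x≤ , tt)     A⊆B small = x⊆ , x≤ , A⊆B , small , tt
  chain-snoc (x ∷ x' ∷ xs) A B (x⊆ , x≤ , chain)  A⊆B small = x⊆ , x≤ , chain-snoc (x' ∷ xs) A B chain A⊆B small

  chain-extend : ∀ A as B → IsCentralChain (reverse (A ∷ as)) → A ⊆ B → length B ≤ 2 *ℕ length A →
                 IsCentralChain (reverse (B ∷ A ∷ as))
  chain-extend A as B chain A⊆B small =
    ≡.subst IsCentralChain (≡.sym (≡.trans (Listₚ.unfold-reverse B (A ∷ as))
                                          (≡.cong (_∷ʳ B) (Listₚ.unfold-reverse A as))))
      (chain-snoc (reverse as) A B (≡.subst IsCentralChain (Listₚ.unfold-reverse A as) chain) A⊆B small)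

  path-head : ∀ {Φ π} → RootLeafPath Φ π → Σ (List Formula) (λ π' → π ≡.≡ Φ ∷ π')
  path-head atLeaf       = _ , ≡.refl
  path-head (viaPlus _ _) = _ , ≡.refl
  path-head (viaLeft _)  = _ , ≡.refl
  path-head (viaRight _) = _ , ≡.refl

module Induction {c ℓ : Level} (𝔽 : Field c ℓ) (n : ℕ) (φ : Partition 𝔽 n)
                 (P : ROABP 𝔽 (2 ^ suc n)) (k : ℕ) where
  open Field 𝔽 using (Carrier; sym)
  open ROABP P
  open Rank 𝔽
  open Arith
  open Monomials 𝔽 n φ using (local-rank-bound)
  open Paths 𝔽 P using (pathSum; pathSum-local; pathSum-split)
  open Reads 𝔽 P using (readsBetween-split)
  open Chains 𝔽 P using (chain-extend; path-head)
  open import Data.Nat using (_≤_; _<_; _<?_; z≤n; s≤s; ∣_-_∣; ⌈_/2⌉)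
  import Data.Nat.Properties as ℕₚ
  open import Data.List using (map)
  import Data.List.Properties as Listₚ
  open import Data.List.Relation.Unary.Any using (Any; here; there)
  open import Data.List.Membership.Propositional.Properties using (∈-++⁺ˡ)
  open import Data.List.Relation.Binary.Subset.Propositional using (_⊆_)
  open import Data.Unit using (tt)
  open import Data.Empty using (⊥-elim)
  open import Relation.Nullary using (¬_)

  Vars : Node → Node → List (Fin (2 ^ suc n))
  Vars u w = readsBetween (lay u) (lay w)

  M : Node → Node → Subset (2 ^ n) → Subset (2 ^ n) → Carrier
  M u w p q = pathSum u (monomial 𝔽 n φ p q) (lay w) (proj₂ w)

  Imbalance : List (Fin (2 ^ suc n)) → ℕ
  Imbalance L = ∣ countY 𝔽 n φ L - countZ 𝔽 n φ L ∣

  RankBound : Node → Node → ℕ → Set (c Level.⊔ ℓ)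
  RankBound u w s = Σ ℕ λ r → Rank (M u w) r × r *ℕ r *ℕ 2 ^ k ≤ s *ℕ s *ℕ 2 ^ length (Vars u w)

  -- M_{[u,w]} only sees the variables in V, so it has the imbalance rank bound
  imbalance-rank : ∀ u w → Σ ℕ λ r → Rank (M u w) r
                     × (∀ j → j ≤ Imbalance (Vars u w) → r *ℕ r *ℕ 2 ^ j ≤ 2 ^ length (Vars u w))
  imbalance-rank u w = local-rank-bound (Vars u w) (λ S → pathSum u S (lay w) (proj₂ w))
                                        (λ S S' → pathSum-local u S S' (lay w) (proj₂ w))

  unbalanced-bound : ∀ u w Φ → k < Imbalance (Vars u w) → RankBound u w (size Φ)
  unbalanced-bound u w Φ unbalanced with imbalance-rank u w
  ... | r , rank , bound =
    r , rank , ℕₚ.≤-trans (bound k (ℕₚ.<⇒≤ unbalanced)) (≤-square-multiple (size Φ) _ (size-positive Φ))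
    where
    size-positive : ∀ Φ → 1 ≤ size Φ
    size-positive (leaf _ _)          = s≤s z≤n
    size-positive (plus _ _ _ _)      = s≤s z≤n
    size-positive (times _ _ _ _ _)   = s≤s z≤n

  right-bound : ∀ v w → Σ ℕ λ r → Rank (M v w) r × r *ℕ r ≤ 2 ^ length (Vars v w)
  right-bound v w with imbalance-rank v w
  ... | r , rank , bound = r , rank , ≡.subst (_≤ 2 ^ length (Vars v w)) (ℕₚ.*-identityʳ _) (bound 0 z≤n)

  left-sizes : ∀ u w ℓ (Φ₁ Φ₂ : Fin (width ℓ) → Formula) →
               sumℕ (width ℓ) (λ v → size (Φ₁ v)) ≤ size (plus u w ℓ (λ v → times u (ℓ , v) w (Φ₁ v) (Φ₂ v)))
  left-sizes u w ℓ Φ₁ Φ₂ = ℕₚ.m≤n⇒m≤1+n (sumℕ-mono (width ℓ) (λ v → ℕₚ.m≤n⇒m≤1+n (ℕₚ.m≤m+n _ _)))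

  -- inductive step: [u,w] = Σ_v [u,v]·[v,w] and rank(A∘B) ≤ rank A · rank B
  split-bound : ∀ u w ℓ (Φ₁ Φ₂ : Fin (width ℓ) → Formula) → lay u ≤ ℓ → ℓ ≤ lay w →
                (∀ v → RankBound u (ℓ , v) (size (Φ₁ v))) →
                RankBound u w (size (plus u w ℓ (λ v → times u (ℓ , v) w (Φ₁ v) (Φ₂ v))))
  split-bound u w ℓ Φ₁ Φ₂ u≤ℓ ℓ≤w left = R , rank , bound
    where
    r₁ r₂ : Fin (width ℓ) → ℕ
    r₁ v = proj₁ (left v)
    r₂ v = proj₁ (right-bound (ℓ , v) w)
    R = sumℕ (width ℓ) (λ v → r₁ v *ℕ r₂ v)
    rank : Rank (M u w) R
    rank = rank-cong (λ p q → sym (pathSum-split u _ ℓ u≤ℓ (lay w) (ℕₚ.≤⇒≤′ ℓ≤w) (proj₂ w)))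
             (rank-∑ (width ℓ) (λ v → rank-hadamard (proj₁ (proj₂ (left v)))
                                                    (proj₁ (proj₂ (right-bound (ℓ , v) w)))))
    lengths : length (readsBetween (lay u) ℓ) +ℕ length (readsBetween ℓ (lay w)) ≡.≡ length (Vars u w)
    lengths = ≡.sym (≡.trans (≡.cong length (readsBetween-split (lay u) ℓ (lay w) u≤ℓ ℓ≤w))
                             (Listₚ.length-++ (readsBetween (lay u) ℓ)))
    term : ∀ v → (r₁ v *ℕ r₂ v) *ℕ (r₁ v *ℕ r₂ v) *ℕ 2 ^ k ≤ size (Φ₁ v) *ℕ size (Φ₁ v) *ℕ 2 ^ length (Vars u w)
    term v = ≡.subst (λ L → (r₁ v *ℕ r₂ v) *ℕ (r₁ v *ℕ r₂ v) *ℕ 2 ^ k ≤ size (Φ₁ v) *ℕ size (Φ₁ v) *ℕ 2 ^ L)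
               lengths
               (product-bound (r₁ v) (r₂ v) (size (Φ₁ v)) k
                  (length (readsBetween (lay u) ℓ)) (length (readsBetween ℓ (lay w)))
                  (proj₂ (proj₂ (left v))) (proj₂ (proj₂ (right-bound (ℓ , v) w))))
    Φ = plus u w ℓ (λ v → times u (ℓ , v) w (Φ₁ v) (Φ₂ v))
    sizes = left-sizes u w ℓ Φ₁ Φ₂
    bound : R *ℕ R *ℕ 2 ^ k ≤ size Φ *ℕ size Φ *ℕ 2 ^ length (Vars u w)
    bound = begin
      R *ℕ R *ℕ 2 ^ k
        ≤⟨ sum-square-bound (width ℓ) _ _ (2 ^ k) (2 ^ length (Vars u w)) term ⟩
      sumℕ (width ℓ) (λ v → size (Φ₁ v)) *ℕ sumℕ (width ℓ) (λ v → size (Φ₁ v)) *ℕ 2 ^ length (Vars u w)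
        ≤⟨ ℕₚ.*-monoˡ-≤ (2 ^ length (Vars u w)) (ℕₚ.*-mono-≤ sizes sizes) ⟩
      size Φ *ℕ size Φ *ℕ 2 ^ length (Vars u w) ∎
      where open ℕₚ.≤-Reasoning

  conv-vars : ∀ {u w Φ} → Conv u w Φ → S Φ ≡.≡ Vars u w
  conv-vars (leafC _ _)                 = ≡.refl
  conv-vars (plusC _ _ _ _ _ _ _ _ _)   = ≡.refl

  -- at a balanced + gate, weakness passes to the left factors: a chain
  -- below Φ₁ v extends through the × gate (whose set V has at most twice
  -- the size, as the split is central) and Φ, neither of which is unbalanced
  weak-left : ∀ {u w ℓ} {Φ₁ Φ₂ : Fin (width ℓ) → Formula} → lay u ≤ ℓ → ℓ ≤ lay w →
              length (readsBetween (lay u) ℓ) ≡.≡ ⌈ length (Vars u w) /2⌉ →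
              (∀ v → Conv u (ℓ , v) (Φ₁ v)) → ¬ k < Imbalance (Vars u w) →
              Weak 𝔽 n φ P k (plus u w ℓ (λ v → times u (ℓ , v) w (Φ₁ v) (Φ₂ v))) →
              ∀ v → Weak 𝔽 n φ P k (Φ₁ v)
  weak-left {u} {w} {ℓ} {Φ₁} {Φ₂} u≤ℓ ℓ≤w central convs balanced weak v π path chain
    with path-head path
  ... | π' , ≡.refl = drop-top (weak (Φ ∷ τ ∷ Φ₁ v ∷ π') (viaPlus v (viaLeft path))
          (chain-extend (S τ) (S (Φ₁ v) ∷ map S π') (S Φ)
            (chain-extend (S (Φ₁ v)) (map S π') (S τ) chain inside twice)
            (λ x∈ → x∈) (ℕₚ.m≤m+n _ _)))   -- S τ = S Φ
    where
    τ = times u (ℓ , v) w (Φ₁ v) (Φ₂ v)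
    Φ = plus u w ℓ (λ v → times u (ℓ , v) w (Φ₁ v) (Φ₂ v))
    S-left : S (Φ₁ v) ≡.≡ readsBetween (lay u) ℓ
    S-left = conv-vars (convs v)
    inside : S (Φ₁ v) ⊆ Vars u w
    inside x∈ rewrite S-left | readsBetween-split (lay u) ℓ (lay w) u≤ℓ ℓ≤w = ∈-++⁺ˡ x∈
    twice : length (Vars u w) ≤ 2 *ℕ length (S (Φ₁ v))
    twice rewrite S-left | central = ≤-twice-⌈/2⌉ (length (Vars u w))
    drop-top : Any (λ g → Unbalanced 𝔽 n φ k (S g)) (Φ ∷ τ ∷ Φ₁ v ∷ π') →
               Any (λ g → Unbalanced 𝔽 n φ k (S g)) (Φ₁ v ∷ π')
    drop-top (here unbalanced)         = ⊥-elim (balanced unbalanced)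
    drop-top (there (here unbalanced)) = ⊥-elim (balanced unbalanced)
    drop-top (there (there rest))      = rest

  rank-bound : ∀ {u w Φ} → Conv u w Φ → Weak 𝔽 n φ P k Φ → RankBound u w (size Φ)
  rank-bound {u} {w} (leafC _ _) weak with weak (leaf u w ∷ []) atLeaf tt
  ... | here unbalanced = unbalanced-bound u w (leaf u w) unbalanced
  rank-bound {u} {w} {Φ} (plusC ℓ Φ₁ Φ₂ u≤ℓ ℓ≤w _ central convs _) weak
    with k <? Imbalance (Vars u w)
  ... | yes unbalanced = unbalanced-bound u w Φ unbalanced
  ... | no  balanced   = split-bound u w ℓ Φ₁ Φ₂ u≤ℓ ℓ≤w (λ v →
          rank-bound (convs v) (weak-left u≤ℓ ℓ≤w central convs balanced weak v))

-- Lemma 13: apply the induction to the root [s,t], whose matrix is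
-- M_{f^φ} and which reads all N = 2^(n+1) variables.

open import Data.Nat using (_*_; _≤_)

lemma13 : ∀ {c ℓ} (𝔽 : Field c ℓ) (n : ℕ) (P : ROABP 𝔽 (2 ^ suc n)) →
          ROABP.ReadInOrder P →
          (Φ : ROABP.Formula P) →
          ROABP.Conv P (0 , ROABP.s P) (ROABP.len P , ROABP.t P) Φ →
          (φ : Partition 𝔽 n) (k : ℕ) →
          Weak 𝔽 n φ P k Φ →
          Σ ℕ (λ r → RankAtMost 𝔽 (partialDerivMatrix 𝔽 n φ P) r
                     × r * r * 2 ^ k ≤ ROABP.size P Φ * ROABP.size P Φ * 2 ^ (2 ^ suc n))
lemma13 𝔽 n P inOrder Φ conv φ k weak
  with Induction.rank-bound 𝔽 n φ P k conv weak
... | r , rank , bound =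
  r ,
  Rank.rank-cong 𝔽 (λ p q → Field.sym 𝔽 (Paths.fromStart≈pathSum 𝔽 P _ (ROABP.len P) (ROABP.t P))) rank ,
  ≡.subst (λ L → r * r * 2 ^ k ≤ ROABP.size P Φ * ROABP.size P Φ * 2 ^ L)
          (Reads.length-all-reads 𝔽 P inOrder) bound
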